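{- Let $X$ be an obstruction containing arcs, and let $C$ be an odd cycle (not necessarily induced) in $\overline{U(X)}$. Then every vertex of $\overline{U(X)}$ either lies on $C$ or is adjacent in $\overline{U(X)}$ to a vertex of $C$. In particular, every cut-vertex of $\overline{U(X)}$ lies on $C$.
   Context: A partially oriented graph $H=(V,E\cup A)$ is obtained from a simple graph $G$ (its underlying graph $U(H)=G$) by orienting some of its edges; $E$ = unoriented edges, $A$ = arcs $(u,v)$. A local tournament is an oriented graph in which the in- and out-neighbourhood of every vertex each induce a tournament. $H$ can be completed to a local tournament if its unoriented edges can be oriented to give a local tournament. An obstruction is a partially oriented graph $X$ that cannot be completed to a local tournament, while $X-v$ can for every vertex $v$, and for every arc $(u,v)$ the graph obtained by replacing $(u,v)$ with the edge $uv$ can. $\overline{U(X)}$ is the complement of $U(X)$. -}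

module Defs where

open import Data.Nat using (ℕ; zero; suc; _*_; _+_; _≤_; pred)
open import Data.Fin using (Fin; zero; suc; _≟_; punchIn; inject₁; fromℕ)
open import Data.Bool using (Bool; true; false; _∧_; not)
open import Data.Product using (Σ; ∃; ∃-syntax; _×_; _,_)
open import Data.Sum using (_⊎_)
open import Data.Empty using (⊥)
open import Relation.Nullary using (¬_; does)
open import Relation.Binary.PropositionalEquality using (_≡_; _≢_)
open import Relation.Binary.Construct.Closure.ReflexiveTransitive using (Star)

-- A partially oriented graph on vertex set Fin n.
-- edge u v : u v adjacent in the underlying simple graph U(H)
-- arc  u v : the edge uv is oriented as the arc (u,v)
-- (an edge with neither arc u v nor arc v u is an unoriented edge)
record POG (n : ℕ) : Set where
  field
    edge : Fin n → Fin n → Bool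
    arc  : Fin n → Fin n → Bool
open POG public

record WF {n : ℕ} (H : POG n) : Set where
  field
    edge-sym    : ∀ u v → edge H u v ≡ edge H v u
    edge-irrefl : ∀ u → edge H u u ≡ false
    arc⇒edge    : ∀ u v → arc H u v ≡ true → edge H u v ≡ true
    arc-asym    : ∀ u v → arc H u v ≡ true → arc H v u ≡ false

Orientation : ℕ → Set
Orientation n = Fin n → Fin n → Bool

IsOriented : ∀ {n} → Orientation n → Set
IsOriented {n} D = (∀ u → D u u ≡ false) × (∀ u v → D u v ≡ true → D v u ≡ false)

IsLocalTournament : ∀ {n} → Orientation n → Set
IsLocalTournament {n} D =
  IsOriented D ×
  (∀ x u v → u ≢ v → D x u ≡ true → D x v ≡ true → D u v ≡ true ⊎ D v u ≡ true) ×
  (∀ x u v → u ≢ v → D u x ≡ true → D v x ≡ true → D u v ≡ true ⊎ D v u ≡ true)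

-- D is obtained from H by orienting its unoriented edges
-- (D has underlying graph U(H) and contains every arc of H)
IsCompletion : ∀ {n} → POG n → Orientation n → Set
IsCompletion H D =
  (∀ u v → D u v ≡ true → edge H u v ≡ true) ×
  (∀ u v → edge H u v ≡ true → D u v ≡ true ⊎ D v u ≡ true) ×
  (∀ u v → arc H u v ≡ true → D u v ≡ true)

CompletableLT : ∀ {n} → POG n → Set
CompletableLT {n} H = ∃[ D ] (IsCompletion H D × IsLocalTournament D)

-- H - v  (vertices of Fin (pred n) relabelled by punchIn v)
deleteV : ∀ {n} → POG n → Fin n → POG (pred n)
deleteV {zero} H ()
deleteV {suc m} H v = record
  { edge = λ a b → edge H (punchIn v a) (punchIn v b)
  ; arc  = λ a b → arc H (punchIn v a) (punchIn v b) }

unorient : ∀ {n} → POG n → Fin n → Fin n → POG n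
unorient H u v = record
  { edge = edge H
  ; arc  = λ a b → arc H a b ∧ not (does (a ≟ u) ∧ does (b ≟ v)) }

record Obstruction {n : ℕ} (X : POG n) : Set where
  field
    wf            : WF X
    not-completable : ¬ CompletableLT X
    delete-ok     : ∀ v → CompletableLT (deleteV X v)
    unorient-ok   : ∀ u v → arc X u v ≡ true → CompletableLT (unorient X u v)

HasArc : ∀ {n} → POG n → Set
HasArc {n} X = ∃[ u ] ∃[ v ] (arc X u v ≡ true)

CoAdj : ∀ {n} → POG n → Fin n → Fin n → Set
CoAdj X u v = u ≢ v × edge X u v ≡ false

Odd : ℕ → Set
Odd L = ∃[ j ] (L ≡ suc (2 * j))

-- an odd cycle (not necessarily induced) of length L = suc k in a graph with
-- adjacency G: distinct vertices c 0, …, c k with c i ~ c (i+1) and c k ~ c 0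
record OddCycle {n : ℕ} (G : Fin n → Fin n → Set) : Set where
  field
    k      : ℕ
    c      : Fin (suc k) → Fin n
    c-inj  : ∀ i j → c i ≡ c j → i ≡ j
    len≥3  : 3 ≤ suc k
    odd    : Odd (suc k)
    steps  : ∀ (i : Fin k) → G (c (inject₁ i)) (c (suc i))
    close  : G (c (fromℕ k)) (c zero)
open OddCycle public

OnCycle : ∀ {n} {G : Fin n → Fin n → Set} → OddCycle G → Fin n → Set
OnCycle C w = ∃[ i ] (c C i ≡ w)

-- w is a cut-vertex of G: removing w disconnects two vertices that
-- were connected (i.e. the number of components increases)
CutVertex : ∀ {n} → (Fin n → Fin n → Set) → Fin n → Set
CutVertex G w = ∃[ a ] ∃[ b ] (a ≢ w × b ≢ w × Star G a b ×
  ¬ Star (λ x y → G x y × x ≢ w × y ≢ w) a b)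

{-# OPTIONS --safe #-}
module Submission where

open import Defs
open import Data.Nat using (ℕ; zero; suc; pred; _+_; _*_)
open import Data.Nat.Properties using (+-suc)
open import Data.Fin using (Fin; zero; suc; toℕ; inject₁; fromℕ; _≟_)
open import Data.Fin.Properties using (any?; toℕ-inject₁; toℕ-fromℕ)
open import Data.Fin.Induction using (<-weakInduction)
open import Data.Bool using (Bool; true; false; not; _xor_)
open import Data.Bool.Properties using (not-involutive; not-¬; ¬-not; not-distribˡ-xor)
  renaming (_≟_ to _≟ᵇ_)
open import Data.Product using (∃-syntax; _×_; _,_)
open import Data.Sum using (_⊎_; inj₁; inj₂)
open import Data.Empty using (⊥; ⊥-elim)
open import Relation.Nullary using (¬_; Dec; yes; no; contradiction)
open import Relation.Binary.Definitions using (Symmetric)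
open import Relation.Binary.PropositionalEquality
open import Relation.Binary.Construct.Closure.ReflexiveTransitive
  using (Star; ε; _◅_; _◅◅_; reverse)

-- If w were neither on C nor co-adjacent to a vertex of C, it would be adjacent in U(X)
-- to every vertex of C.  Since X has an arc, un-orienting it gives a completable graph,
-- so U(X) is the underlying graph of some local tournament D.  Two non-adjacent
-- neighbours of w in D cannot both be out-neighbours, nor both in-neighbours, of w;
-- consecutive vertices of C are non-adjacent, so the direction of the arc between w and
-- the vertices of C alternates around C, which is impossible as C is odd.  Consequently
-- C dominates the complement, so removing a vertex off C leaves a graph that is still
-- connected through C.

private
  variable
    n : ℕ
    G : Fin n → Fin n → Set
    X : POG n

parity : ℕ → Bool
parity zero    = false
parity (suc m) = not (parity m)

parity-even : ∀ j → parity (2 * j) ≡ false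
parity-even zero    = refl
parity-even (suc j) rewrite +-suc j (j + 0) =
  trans (not-involutive (parity (2 * j))) (parity-even j)

oddCycle-not-2-colourable : (C : OddCycle G) (col : Fin n → Bool) →
  (∀ i j → G (c C i) (c C j) → col (c C j) ≡ not (col (c C i))) → ⊥
oddCycle-not-2-colourable C col alternates with odd C
... | j , len≡ = not-¬ (sym end≡start) start≡end
  where
    open ≡-Reasoning

    col₀ : Bool
    col₀ = col (c C zero)

    step : ∀ i → col (c C (inject₁ i)) ≡ parity (toℕ (inject₁ i)) xor col₀ →
           col (c C (suc i)) ≡ parity (toℕ (suc i)) xor col₀
    step i hyp = begin
      col (c C (suc i))                         ≡⟨ alternates _ _ (steps C i) ⟩
      not (col (c C (inject₁ i)))               ≡⟨ cong not hyp ⟩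
      not (parity (toℕ (inject₁ i)) xor col₀)   ≡⟨ cong (λ m → not (parity m xor col₀)) (toℕ-inject₁ i) ⟩
      not (parity (toℕ i) xor col₀)             ≡⟨ not-distribˡ-xor (parity (toℕ i)) col₀ ⟩
      parity (toℕ (suc i)) xor col₀             ∎

    colour-along : ∀ i → col (c C i) ≡ parity (toℕ i) xor col₀
    colour-along = <-weakInduction (λ i → col (c C i) ≡ parity (toℕ i) xor col₀) refl step

    end≡start : col (c C (fromℕ (k C))) ≡ col₀
    end≡start = begin
      col (c C (fromℕ (k C)))               ≡⟨ colour-along (fromℕ (k C)) ⟩
      parity (toℕ (fromℕ (k C))) xor col₀   ≡⟨ cong (λ m → parity m xor col₀) (toℕ-fromℕ (k C)) ⟩
      parity (k C) xor col₀                 ≡⟨ cong (λ m → parity m xor col₀) (cong pred len≡) ⟩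
      parity (2 * j) xor col₀               ≡⟨ cong (_xor col₀) (parity-even j) ⟩
      col₀                                  ∎

    start≡end : col₀ ≡ not (col (c C (fromℕ (k C))))
    start≡end = alternates _ _ (close C)

onCycle? : (C : OddCycle G) (w : Fin n) → Dec (OnCycle C w)
onCycle? C w = any? (λ i → c C i ≟ w)

cycle-connected : (C : OddCycle G) → ∀ i → Star G (c C zero) (c C i)
cycle-connected {G = G} C =
  <-weakInduction (λ i → Star G (c C zero) (c C i)) ε (λ i path → path ◅◅ (steps C i ◅ ε))

Avoiding : (Fin n → Fin n → Set) → Fin n → Fin n → Fin n → Set
Avoiding G w x y = G x y × x ≢ w × y ≢ w

avoiding-sym : Symmetric G → ∀ {w} → Symmetric (Avoiding G w)
avoiding-sym G-sym (xy , x≢w , y≢w) = G-sym xy , y≢w , x≢w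

cycle-avoiding : (C : OddCycle G) → ∀ {w} → ¬ OnCycle C w → OddCycle (Avoiding G w)
cycle-avoiding C ¬on = record
  { k     = k C
  ; c     = c C
  ; c-inj = c-inj C
  ; len≥3 = len≥3 C
  ; odd   = odd C
  ; steps = λ i → steps C i , avoids _ , avoids _
  ; close = close C , avoids _ , avoids _
  }
  where
    avoids : ∀ i → c C i ≢ _
    avoids i ci≡w = ¬on (i , ci≡w)

dominating-cycle-contains-cutVertices : Symmetric G → (C : OddCycle G) →
  (∀ v → OnCycle C v ⊎ ∃[ i ] G (c C i) v) → ∀ w → CutVertex G w → OnCycle C w
dominating-cycle-contains-cutVertices {G = G} G-sym C dominating w
  (a , b , a≢w , b≢w , _ , disconnected) with onCycle? C w
... | yes on = on
... | no ¬on = ⊥-elim (disconnected (to-cycle a a≢w ◅◅ reverse G-w-sym (to-cycle b b≢w)))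
  where
    G-w-sym : Symmetric (Avoiding G w)
    G-w-sym = avoiding-sym G-sym

    from-cycle : ∀ i → Star (Avoiding G w) (c C i) (c C zero)
    from-cycle i = reverse G-w-sym (cycle-connected (cycle-avoiding C ¬on) i)

    to-cycle : ∀ x → x ≢ w → Star (Avoiding G w) x (c C zero)
    to-cycle x x≢w with dominating x
    ... | inj₁ (i , refl) = from-cycle i
    ... | inj₂ (i , ci~x) = G-w-sym (ci~x , (λ ci≡w → ¬on (i , ci≡w)) , x≢w) ◅ from-cycle i

Adjacent : Orientation n → Fin n → Fin n → Set
Adjacent D u v = D u v ≡ true ⊎ D v u ≡ true

SameUnderlyingGraph : Orientation n → POG n → Set
SameUnderlyingGraph D H =
  (∀ {u v} → Adjacent D u v → edge H u v ≡ true) ×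
  (∀ {u v} → edge H u v ≡ true → Adjacent D u v)

adjacent-¬out⇒in : ∀ (D : Orientation n) {u v} → Adjacent D u v → D u v ≡ false → D v u ≡ true
adjacent-¬out⇒in D (inj₁ uv) ¬uv = contradiction (trans (sym uv) ¬uv) λ ()
adjacent-¬out⇒in D (inj₂ vu) _   = vu

localTournament-alternates : ∀ (D : Orientation n) → IsLocalTournament D → ∀ {w a b} → a ≢ b →
  ¬ Adjacent D a b → Adjacent D w a → Adjacent D w b → D w b ≡ not (D w a)
localTournament-alternates D (_ , out-tournament , in-tournament) {w} {a} {b} a≢b ¬ab wa wb =
  bool-opposite (D w a) (D w b)
    (λ w→a w→b → ¬ab (out-tournament w a b a≢b w→a w→b))
    (λ ¬w→a ¬w→b → ¬ab (in-tournament w a b a≢b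
      (adjacent-¬out⇒in D wa ¬w→a) (adjacent-¬out⇒in D wb ¬w→b)))
  where
    bool-opposite : ∀ x y → (x ≡ true → y ≡ true → ⊥) → (x ≡ false → y ≡ false → ⊥) →
                    y ≡ not x
    bool-opposite true  true  ¬tt _   = ⊥-elim (¬tt refl refl)
    bool-opposite true  false _   _   = refl
    bool-opposite false true  _   _   = refl
    bool-opposite false false _   ¬ff = ⊥-elim (¬ff refl refl)

completion-sameUnderlyingGraph : ∀ {H : POG n} {D} → (∀ u v → edge H u v ≡ edge H v u) →
  IsCompletion H D → SameUnderlyingGraph D H
completion-sameUnderlyingGraph {H = H} {D} edge-sym (D⊆H , H⊆D , _) = D⇒edge , H⊆D _ _
  where
    D⇒edge : ∀ {u v} → Adjacent D u v → edge H u v ≡ true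
    D⇒edge {u} {v} (inj₁ uv) = D⊆H u v uv
    D⇒edge {u} {v} (inj₂ vu) = trans (edge-sym u v) (D⊆H v u vu)

obstruction-underlies-localTournament : Obstruction X → HasArc X →
  ∃[ D ] IsLocalTournament D × SameUnderlyingGraph D X
obstruction-underlies-localTournament ob (u , v , uv) with Obstruction.unorient-ok ob u v uv
... | D , completion , lt =
  D , lt , completion-sameUnderlyingGraph (WF.edge-sym (Obstruction.wf ob)) completion

coAdj-sym : (∀ u v → edge X u v ≡ edge X v u) → Symmetric (CoAdj X)
coAdj-sym edge-sym {u} {v} (u≢v , ¬uv) = ≢-sym u≢v , trans (edge-sym v u) ¬uv

oddCoCycle-has-no-common-neighbour : ∀ {D : Orientation n} →
  IsLocalTournament D → SameUnderlyingGraph D X → (C : OddCycle (CoAdj X)) →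
  ∀ w → ¬ (∀ i → edge X w (c C i) ≡ true)
oddCoCycle-has-no-common-neighbour {D = D} lt (D⇒edge , edge⇒D) C w w~C =
  oddCycle-not-2-colourable C (D w) λ i j (ci≢cj , ¬ci~cj) →
    localTournament-alternates D lt ci≢cj (λ adj → not-¬ ¬ci~cj (D⇒edge adj))
      (edge⇒D (w~C i)) (edge⇒D (w~C j))

no-common-neighbour⇒dominating : (∀ u v → edge X u v ≡ edge X v u) →
  (C : OddCycle (CoAdj X)) → (∀ w → ¬ (∀ i → edge X w (c C i) ≡ true)) →
  ∀ w → OnCycle C w ⊎ ∃[ i ] CoAdj X (c C i) w
no-common-neighbour⇒dominating {X = X} edge-sym C no-common w with onCycle? C w
... | yes on = inj₁ on
... | no ¬on with any? (λ i → edge X (c C i) w ≟ᵇ false)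
...   | yes (i , ¬ci~w) = inj₂ (i , (λ ci≡w → ¬on (i , ci≡w)) , ¬ci~w)
...   | no ¬any = ⊥-elim (no-common w λ i →
        trans (edge-sym w (c C i)) (¬-not λ ¬ci~w → ¬any (i , ¬ci~w)))

lemma4p4 : ∀ {n : ℕ} (X : POG n) → Obstruction X → HasArc X →
    (C : OddCycle (CoAdj X)) →
    (∀ (w : Fin n) → OnCycle C w ⊎ (∃[ i ] CoAdj X (c C i) w)) ×
    (∀ (w : Fin n) → CutVertex (CoAdj X) w → OnCycle C w)
lemma4p4 X ob has-arc C =
  dominating , dominating-cycle-contains-cutVertices (coAdj-sym {X = X} edge-sym) C dominating
  where
    open WF (Obstruction.wf ob) using (edge-sym)

    dominating : ∀ w → OnCycle C w ⊎ ∃[ i ] CoAdj X (c C i) w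
    dominating with obstruction-underlies-localTournament ob has-arc
    ... | D , lt , same =
      no-common-neighbour⇒dominating {X = X} edge-sym C
        (oddCoCycle-has-no-common-neighbour {X = X} lt same C)
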